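{- For every $k\geq 1$, the graph $G_k^+$ is isomorphic to the odd graph $O_k=K(2k+1,k)$.
   Context: The Kneser graph $K(2k+1,k)$ has as vertices the $k$-element subsets of $\{1,\ldots,2k+1\}$, two being adjacent iff disjoint. For a bitstring $x$, $\overline{x}$ denotes its complement (every bit flipped). Let $B_k^0$ and $B_k^1$ be the sets of bitstrings of length $2k$ with exactly $k$ and exactly $k+1$ ones, respectively, and $B_k=B_k^0\cup B_k^1$. $G_k$ is the graph on $B_k$ in which two bitstrings are adjacent iff they differ in exactly one bit. $G_k^+$ is obtained from $G_k$ by adding all edges $\{x,\overline{x}\}$ with $x\in B_k^0$. -}

module Defs where

open import Data.Nat using (ℕ; suc; _+_; _*_)
open import Data.Bool using (Bool; true; false; not)
open import Data.Vec using (Vec; []; _∷_; map; count)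
open import Data.Fin using (Fin)
open import Data.Fin.Subset using (Subset; ∣_∣; _∩_; ⊥)
open import Data.Product using (Σ; _×_; proj₁)
open import Data.Sum using (_⊎_)
open import Relation.Binary.PropositionalEquality using (_≡_)
open import Function.Bundles using (_⤖_; Bijection)
open import Relation.Binary using (Rel)
open import Level using (0ℓ)

record Graph : Set₁ where
  field
    V   : Set
    Adj : V → V → Set

open Graph public

record _≅_ (G H : Graph) : Set where
  field
    bij  : V G ⤖ V H
    adj⇔ : ∀ u v → (Adj G u v → Adj H (Bijection.to bij u) (Bijection.to bij v))
                 × (Adj H (Bijection.to bij u) (Bijection.to bij v) → Adj G u v)

ones : ∀ {n} → Vec Bool n → ℕ
ones = count (λ b → b Data.Bool.≟ true)

hamming : ∀ {n} → Vec Bool n → Vec Bool n → ℕ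
hamming [] [] = 0
hamming (true ∷ xs) (true ∷ ys) = hamming xs ys
hamming (false ∷ xs) (false ∷ ys) = hamming xs ys
hamming (true ∷ xs) (false ∷ ys) = suc (hamming xs ys)
hamming (false ∷ xs) (true ∷ ys) = suc (hamming xs ys)

compl : ∀ {n} → Vec Bool n → Vec Bool n
compl = map not

-- B_k = B_k^0 ∪ B_k^1 : bitstrings of length 2k with k or k+1 ones
B : ℕ → Set
B k = Σ (Vec Bool (2 * k)) (λ x → (ones x ≡ k) ⊎ (ones x ≡ suc k))

Gk+ : ℕ → Graph
Gk+ k = record
  { V   = B k
  ; Adj = λ x y →
      (hamming (proj₁ x) (proj₁ y) ≡ 1)
      ⊎ ((ones (proj₁ x) ≡ k) × (proj₁ y ≡ compl (proj₁ x)))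
      ⊎ ((ones (proj₁ y) ≡ k) × (proj₁ x ≡ compl (proj₁ y)))
  }

Kneser : ℕ → ℕ → Graph
Kneser n r = record
  { V   = Σ (Subset n) (λ s → ∣ s ∣ ≡ r)
  ; Adj = λ s t → proj₁ s ∩ proj₁ t ≡ ⊥
  }

Odd : ℕ → Graph
Odd k = Kneser (2 * k + 1) k

module Submission where

-- Write n = 2k.  A string x ∈ B_k^0 is sent to the k-set x·0 ⊆ [2k+1] and a
-- string x ∈ B_k^1 to the k-set x̄·1; the last coordinate of a k-subset of
-- [2k+1] tells which case it came from, so this is a bijection B_k → V(O_k).
-- Adjacency is controlled by the counting identity
--     d(x,y) + 2|x ∩ y| = |x| + |y|          (d = Hamming distance),
-- together with |z| = 0 ⇔ z = ∅ and d(x,y) = n ⇒ y = x̄: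
--  * x, y ∈ B^0: d(x,y) = 1 is impossible by parity, and x·0, y·0 are
--    disjoint ⇔ x ∩ y = ∅ ⇔ d(x,y) = 2k ⇔ y = x̄;
--  * x ∈ B^0, y ∈ B^1: x·0, ȳ·1 are disjoint ⇔ |x ∩ ȳ| = 0 ⇔ |x ∩ y| = k
--    ⇔ d(x,y) = 1, while complement edges are excluded by counting ones;
--  * x, y ∈ B^1: both images contain 2k+1, and G_k^+ has no such edge.

open import Defs
open import Data.Nat using (ℕ; _≥_)
open import Data.Nat using (zero; suc; _+_; _*_; _≤_; z≤n; s≤s)
open import Data.Nat.Properties
  using (+-suc; +-comm; +-identityʳ; +-cancelˡ-≡; +-cancelʳ-≡; *-cancelˡ-≡;
         m∸n+n≡m; m≤n⇒m≤1+n; 1+n≰n; suc-injective; 1+n≢n; even≢odd; ≡-irrelevant)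
open import Data.Nat.Tactic.RingSolver using (solve-∀)
open import Data.Bool using (Bool; true; false; not; _∧_)
open import Data.Bool.Properties using (not-involutive)
open import Data.Vec using (Vec; []; _∷_; _++_)
open import Data.Vec.Properties using (map-∘; map-cong; map-id; zipWith-++; ++-injective; ∷-injectiveˡ)
open import Data.Fin.Subset using (_∩_; ⊥)
open import Data.Fin.Subset.Properties using (∩-comm; ∩-inverseʳ; ∣⊥∣≡0; ∣∁p∣≡n∸∣p∣; ∣p∣≤n)
open import Data.Product using (_×_; _,_; proj₁; proj₂)
open import Data.Sum using (_⊎_; inj₁; inj₂)
open import Data.Empty using (⊥-elim)
open import Relation.Nullary using (¬_; contradiction)
open import Relation.Binary.PropositionalEquality
open import Function.Bundles using (_⤖_; _⇔_; mk⇔; mk↔ₛ′; Equivalence)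
open import Function.Properties.Inverse using (↔⇒⤖)
import Function.Properties.Equivalence as ⇔

open ≡-Reasoning

private
  variable
    m n : ℕ

double : ∀ a → 2 * a ≡ a + a
double = solve-∀

double-suc : ∀ h c → h + 2 * suc c ≡ 2 + (h + 2 * c)
double-suc = solve-∀

complement-half : ∀ a b k → b + a ≡ 2 * k → a ≡ k → b ≡ k
complement-half a b k b+a≡2k refl = +-cancelʳ-≡ a b a (trans b+a≡2k (double a))

complement-succ : ∀ a b k → b + a ≡ 2 * k → (a ≡ suc k) ⇔ (b + 1 ≡ k)
complement-succ a b k b+a≡2k = mk⇔ down up
  where
  shift : ∀ b k → (b + 1) + k ≡ b + suc k
  shift = solve-∀

  down : a ≡ suc k → b + 1 ≡ k
  down refl = +-cancelʳ-≡ k (b + 1) k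
    (trans (shift b k) (trans b+a≡2k (double k)))

  up : b + 1 ≡ k → a ≡ suc k
  up refl = +-cancelˡ-≡ b a (suc k)
    (trans b+a≡2k (trans (double (b + 1)) (shift b (b + 1))))

odd-split : ∀ h c k → h + 2 * c ≡ k + suc k → (h ≡ 1) ⇔ (c ≡ k)
odd-split h c k eq = mk⇔ halve distance-one
  where
  k+sk : k + suc k ≡ 1 + 2 * k
  k+sk = trans (+-suc k k) (cong suc (sym (double k)))

  halve : h ≡ 1 → c ≡ k
  halve refl = *-cancelˡ-≡ c k 2 (suc-injective (trans eq k+sk))

  distance-one : c ≡ k → h ≡ 1
  distance-one refl = +-cancelʳ-≡ (2 * c) h 1 (trans eq k+sk)

weight-class-irrelevant : ∀ {a k} (p q : (a ≡ k) ⊎ (a ≡ suc k)) → p ≡ q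
weight-class-irrelevant (inj₁ p) (inj₁ q) = cong inj₁ (≡-irrelevant p q)
weight-class-irrelevant (inj₁ p) (inj₂ q) = contradiction (trans (sym q) p) 1+n≢n
weight-class-irrelevant (inj₂ p) (inj₁ q) = contradiction (trans (sym p) q) 1+n≢n
weight-class-irrelevant (inj₂ p) (inj₂ q) = cong inj₂ (≡-irrelevant p q)

ones-++ : (x : Vec Bool m) (y : Vec Bool n) → ones (x ++ y) ≡ ones x + ones y
ones-++ [] y = refl
ones-++ (true ∷ x) y = cong suc (ones-++ x y)
ones-++ (false ∷ x) y = ones-++ x y

ones-compl : (x : Vec Bool n) → ones (compl x) + ones x ≡ n
ones-compl x = trans (cong (_+ ones x) (∣∁p∣≡n∸∣p∣ x)) (m∸n+n≡m (∣p∣≤n x))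

compl-involutive : (x : Vec Bool n) → compl (compl x) ≡ x
compl-involutive x = trans (sym (map-∘ not not x)) (trans (map-cong not-involutive x) (map-id x))

compl-swap : (x y : Vec Bool n) → x ≡ compl y → y ≡ compl x
compl-swap x y x≡ȳ = trans (sym (compl-involutive y)) (cong compl (sym x≡ȳ))

ones≡0⇔⊥ : (z : Vec Bool n) → (ones z ≡ 0) ⇔ (z ≡ ⊥)
ones≡0⇔⊥ {n} z = mk⇔ (empty z) (λ z≡⊥ → trans (cong ones z≡⊥) (∣⊥∣≡0 n))
  where
  empty : (z : Vec Bool m) → ones z ≡ 0 → z ≡ ⊥
  empty [] _ = refl
  empty (true ∷ z) ()
  empty (false ∷ z) eq = cong (false ∷_) (empty z eq)

ones-split : (x y : Vec Bool n) → ones (x ∩ y) + ones (x ∩ compl y) ≡ ones x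
ones-split [] [] = refl
ones-split (true ∷ x) (true ∷ y) = cong suc (ones-split x y)
ones-split (true ∷ x) (false ∷ y) = trans (+-suc _ _) (cong suc (ones-split x y))
ones-split (false ∷ x) (_ ∷ y) = ones-split x y

hamming-ones : (x y : Vec Bool n) → hamming x y + 2 * ones (x ∩ y) ≡ ones x + ones y
hamming-ones [] [] = refl
hamming-ones (true ∷ x) (true ∷ y) = begin
  hamming x y + 2 * suc (ones (x ∩ y)) ≡⟨ double-suc (hamming x y) (ones (x ∩ y)) ⟩
  2 + (hamming x y + 2 * ones (x ∩ y)) ≡⟨ cong (2 +_) (hamming-ones x y) ⟩
  2 + (ones x + ones y)                ≡⟨ cong suc (sym (+-suc (ones x) (ones y))) ⟩
  suc (ones x) + suc (ones y)          ∎
hamming-ones (true ∷ x) (false ∷ y) = cong suc (hamming-ones x y)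
hamming-ones (false ∷ x) (true ∷ y) = trans (cong suc (hamming-ones x y)) (sym (+-suc _ _))
hamming-ones (false ∷ x) (false ∷ y) = hamming-ones x y

-- Strings of equal weight are at even distance, in particular not at distance 1.
hamming≢1 : (x y : Vec Bool n) → ones x ≡ ones y → ¬ (hamming x y ≡ 1)
hamming≢1 x y same d≡1 = even≢odd (ones x) (ones (x ∩ y)) (begin
  2 * ones x                          ≡⟨ double (ones x) ⟩
  ones x + ones x                     ≡⟨ cong (ones x +_) same ⟩
  ones x + ones y                     ≡⟨ sym (hamming-ones x y) ⟩
  hamming x y + 2 * ones (x ∩ y)      ≡⟨ cong (_+ 2 * ones (x ∩ y)) d≡1 ⟩
  suc (2 * ones (x ∩ y))              ∎)

hamming-disjoint : (x y : Vec Bool n) → x ∩ y ≡ ⊥ → hamming x y ≡ ones x + ones y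
hamming-disjoint x y x∩y≡⊥ = begin
  hamming x y                     ≡⟨ sym (+-identityʳ (hamming x y)) ⟩
  hamming x y + 2 * 0             ≡⟨ cong (λ c → hamming x y + 2 * c) (sym (Equivalence.from (ones≡0⇔⊥ (x ∩ y)) x∩y≡⊥)) ⟩
  hamming x y + 2 * ones (x ∩ y)  ≡⟨ hamming-ones x y ⟩
  ones x + ones y                 ∎

hamming-sym : (x y : Vec Bool n) → hamming x y ≡ hamming y x
hamming-sym [] [] = refl
hamming-sym (true ∷ x) (true ∷ y) = hamming-sym x y
hamming-sym (true ∷ x) (false ∷ y) = cong suc (hamming-sym x y)
hamming-sym (false ∷ x) (true ∷ y) = cong suc (hamming-sym x y)
hamming-sym (false ∷ x) (false ∷ y) = hamming-sym x y

hamming≤n : (x y : Vec Bool n) → hamming x y ≤ n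
hamming≤n [] [] = z≤n
hamming≤n (true ∷ x) (true ∷ y) = m≤n⇒m≤1+n (hamming≤n x y)
hamming≤n (true ∷ x) (false ∷ y) = s≤s (hamming≤n x y)
hamming≤n (false ∷ x) (true ∷ y) = s≤s (hamming≤n x y)
hamming≤n (false ∷ x) (false ∷ y) = m≤n⇒m≤1+n (hamming≤n x y)

hamming≡n⇒compl : (x y : Vec Bool n) → hamming x y ≡ n → y ≡ compl x
hamming≡n⇒compl [] [] _ = refl
hamming≡n⇒compl {suc n} (true ∷ x) (true ∷ y) eq = ⊥-elim (1+n≰n (subst (_≤ n) eq (hamming≤n x y)))
hamming≡n⇒compl (true ∷ x) (false ∷ y) eq = cong (false ∷_) (hamming≡n⇒compl x y (suc-injective eq))
hamming≡n⇒compl (false ∷ x) (true ∷ y) eq = cong (true ∷_) (hamming≡n⇒compl x y (suc-injective eq))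
hamming≡n⇒compl {suc n} (false ∷ x) (false ∷ y) eq = ⊥-elim (1+n≰n (subst (_≤ n) eq (hamming≤n x y)))

data SnocView {A : Set} : Vec A (n + 1) → Set where
  _⊳_ : (x : Vec A n) (b : A) → SnocView (x ++ b ∷ [])

snocView : {A : Set} (s : Vec A (n + 1)) → SnocView s
snocView {zero} (b ∷ []) = [] ⊳ b
snocView {suc n} (a ∷ s) with snocView s
... | x ⊳ b = (a ∷ x) ⊳ b

snocView-++ : {A : Set} (x : Vec A n) (b : A) → snocView (x ++ b ∷ []) ≡ x ⊳ b
snocView-++ [] b = refl
snocView-++ (a ∷ x) b rewrite snocView-++ x b = refl

⊥-snoc : ⊥ {n + 1} ≡ ⊥ {n} ++ false ∷ []
⊥-snoc {zero} = refl
⊥-snoc {suc n} = cong (false ∷_) (⊥-snoc {n})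

snoc-disjoint : (x y : Vec Bool n) (a b : Bool) →
                ((x ++ a ∷ []) ∩ (y ++ b ∷ []) ≡ ⊥) ⇔ ((x ∩ y ≡ ⊥) × (a ∧ b ≡ false))
snoc-disjoint x y a b = mk⇔ split join
  where
  split : (x ++ a ∷ []) ∩ (y ++ b ∷ []) ≡ ⊥ → (x ∩ y ≡ ⊥) × (a ∧ b ≡ false)
  split eq with ++-injective (x ∩ y) ⊥ (trans (sym (zipWith-++ _∧_ x (a ∷ []) y (b ∷ []))) (trans eq ⊥-snoc))
  ... | x∩y≡⊥ , last≡ = x∩y≡⊥ , ∷-injectiveˡ last≡

  join : (x ∩ y ≡ ⊥) × (a ∧ b ≡ false) → (x ++ a ∷ []) ∩ (y ++ b ∷ []) ≡ ⊥
  join (x∩y≡⊥ , a∧b≡false) = begin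
    (x ++ a ∷ []) ∩ (y ++ b ∷ []) ≡⟨ zipWith-++ _∧_ x (a ∷ []) y (b ∷ []) ⟩
    (x ∩ y) ++ (a ∧ b) ∷ []       ≡⟨ cong₂ (λ z c → z ++ c ∷ []) x∩y≡⊥ a∧b≡false ⟩
    ⊥ ++ false ∷ []               ≡⟨ sym ⊥-snoc ⟩
    ⊥                             ∎

module Isomorphism (k : ℕ) where

  Vertex : Set
  Vertex = V (Odd k)

  B-ext : {u v : B k} → proj₁ u ≡ proj₁ v → u ≡ v
  B-ext {x , p} {.x , q} refl = cong (x ,_) (weight-class-irrelevant p q)

  Vertex-ext : {s t : Vertex} → proj₁ s ≡ proj₁ t → s ≡ t
  Vertex-ext {s , p} {.s , q} refl = cong (s ,_) (≡-irrelevant p q)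

  compl-half : (x : Vec Bool (2 * k)) → ones x ≡ k → ones (compl x) ≡ k
  compl-half x = complement-half (ones x) (ones (compl x)) k (ones-compl x)

  compl-succ : (x : Vec Bool (2 * k)) → (ones x ≡ suc k) ⇔ (ones (compl x) + 1 ≡ k)
  compl-succ x = complement-succ (ones x) (ones (compl x)) k (ones-compl x)

  compl-succ′ : (x : Vec Bool (2 * k)) → ones x + 1 ≡ k → ones (compl x) ≡ suc k
  compl-succ′ x = Equivalence.from
    (complement-succ (ones (compl x)) (ones x) k (trans (+-comm (ones x) _) (ones-compl x)))

  encode : B k → Vertex
  encode (x , inj₁ p) = x ++ false ∷ [] , trans (ones-++ x (false ∷ [])) (trans (+-identityʳ (ones x)) p)
  encode (x , inj₂ p) = compl x ++ true ∷ [] , trans (ones-++ (compl x) (true ∷ [])) (Equivalence.to (compl-succ x) p)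

  decodeView : {s : Vec Bool (2 * k + 1)} → SnocView s → ones s ≡ k → B k
  decodeView (x ⊳ false) p = x , inj₁ (trans (sym (+-identityʳ (ones x))) (trans (sym (ones-++ x (false ∷ []))) p))
  decodeView (x ⊳ true) p = compl x , inj₂ (compl-succ′ x (trans (sym (ones-++ x (true ∷ []))) p))

  decode : Vertex → B k
  decode (s , p) = decodeView (snocView s) p

  decode-snoc : ∀ x b (p : ones (x ++ b ∷ []) ≡ k) → decode (x ++ b ∷ [] , p) ≡ decodeView (x ⊳ b) p
  decode-snoc x b p = cong (λ v → decodeView v p) (snocView-++ x b)

  encode-decodeView : {s : Vec Bool (2 * k + 1)} (v : SnocView s) (p : ones s ≡ k) →
                      proj₁ (encode (decodeView v p)) ≡ s
  encode-decodeView (x ⊳ false) p = refl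
  encode-decodeView (x ⊳ true) p = cong (_++ true ∷ []) (compl-involutive x)

  encode-decode : ∀ s → encode (decode s) ≡ s
  encode-decode (s , p) = Vertex-ext (encode-decodeView (snocView s) p)

  decode-encode : ∀ u → decode (encode u) ≡ u
  decode-encode (x , inj₁ p) = B-ext (cong proj₁ (decode-snoc x false _))
  decode-encode (x , inj₂ p) = B-ext (trans (cong proj₁ (decode-snoc (compl x) true _)) (compl-involutive x))

  bijection : B k ⤖ Vertex
  bijection = ↔⇒⤖ (mk↔ₛ′ encode decode encode-decode decode-encode)

  Edge⇔ : B k → B k → Set
  Edge⇔ u v = Adj (Gk+ k) u v ⇔ Adj (Odd k) (encode u) (encode v)

  edges-00 : ∀ x y p q → Edge⇔ (x , inj₁ p) (y , inj₁ q)
  edges-00 x y p q = ⇔.trans (mk⇔ complement-edge flip-edge)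
                      (⇔.trans (⇔.sym disjoint⇔compl) (⇔.sym last-bits))
    where
    complement-edge : Adj (Gk+ k) (x , inj₁ p) (y , inj₁ q) → y ≡ compl x
    complement-edge (inj₁ d≡1) = ⊥-elim (hamming≢1 x y (trans p (sym q)) d≡1)
    complement-edge (inj₂ (inj₁ (_ , y≡x̄))) = y≡x̄
    complement-edge (inj₂ (inj₂ (_ , x≡ȳ))) = compl-swap x y x≡ȳ

    flip-edge : y ≡ compl x → Adj (Gk+ k) (x , inj₁ p) (y , inj₁ q)
    flip-edge y≡x̄ = inj₂ (inj₁ (p , y≡x̄))

    disjoint⇔compl : (x ∩ y ≡ ⊥) ⇔ (y ≡ compl x)
    disjoint⇔compl = mk⇔
      (λ x∩y≡⊥ → hamming≡n⇒compl x y
        (trans (hamming-disjoint x y x∩y≡⊥) (trans (cong₂ _+_ p q) (sym (double k)))))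
      (λ y≡x̄ → trans (cong (x ∩_) y≡x̄) (∩-inverseʳ x))

    last-bits : Adj (Odd k) (encode (x , inj₁ p)) (encode (y , inj₁ q)) ⇔ (x ∩ y ≡ ⊥)
    last-bits = mk⇔ (λ d → proj₁ (Equivalence.to (snoc-disjoint x y false false) d))
                     (λ d → Equivalence.from (snoc-disjoint x y false false) (d , refl))

  edges-01 : ∀ x y p q → Edge⇔ (x , inj₁ p) (y , inj₂ q)
  edges-01 x y p q = ⇔.trans (mk⇔ flip-edge inj₁)
    (⇔.trans (odd-split (hamming x y) (ones (x ∩ y)) k distance)
    (⇔.trans meet-weights (⇔.trans (ones≡0⇔⊥ (x ∩ compl y)) (⇔.sym last-bits))))
    where
    flip-edge : Adj (Gk+ k) (x , inj₁ p) (y , inj₂ q) → hamming x y ≡ 1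
    flip-edge (inj₁ d≡1) = d≡1
    flip-edge (inj₂ (inj₁ (_ , y≡x̄))) =
      contradiction (trans (sym q) (trans (cong ones y≡x̄) (compl-half x p))) 1+n≢n
    flip-edge (inj₂ (inj₂ (|y|≡k , _))) = contradiction (trans (sym q) |y|≡k) 1+n≢n

    distance : hamming x y + 2 * ones (x ∩ y) ≡ k + suc k
    distance = trans (hamming-ones x y) (cong₂ _+_ p q)

    -- |x ∩ y| + |x ∩ ȳ| = k, so |x ∩ y| = k iff |x ∩ ȳ| = 0.
    meet-weights : (ones (x ∩ y) ≡ k) ⇔ (ones (x ∩ compl y) ≡ 0)
    meet-weights = mk⇔
      (λ c≡k → +-cancelˡ-≡ k _ 0 (trans (cong (_+ ones (x ∩ compl y)) (sym c≡k))
        (trans (ones-split x y) (trans p (sym (+-identityʳ k))))))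
      (λ c′≡0 → trans (sym (+-identityʳ _))
        (trans (cong (ones (x ∩ y) +_) (sym c′≡0)) (trans (ones-split x y) p)))

    last-bits : Adj (Odd k) (encode (x , inj₁ p)) (encode (y , inj₂ q)) ⇔ (x ∩ compl y ≡ ⊥)
    last-bits = mk⇔ (λ d → proj₁ (Equivalence.to (snoc-disjoint x (compl y) false true) d))
                     (λ d → Equivalence.from (snoc-disjoint x (compl y) false true) (d , refl))

  edges-11 : ∀ x y p q → Edge⇔ (x , inj₂ p) (y , inj₂ q)
  edges-11 x y p q = mk⇔ (λ e → ⊥-elim (no-G-edge e)) (λ d → ⊥-elim (no-O-edge d))
    where
    no-G-edge : ¬ Adj (Gk+ k) (x , inj₂ p) (y , inj₂ q)
    no-G-edge (inj₁ d≡1) = hamming≢1 x y (trans p (sym q)) d≡1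
    no-G-edge (inj₂ (inj₁ (|x|≡k , _))) = 1+n≢n (trans (sym p) |x|≡k)
    no-G-edge (inj₂ (inj₂ (|y|≡k , _))) = 1+n≢n (trans (sym q) |y|≡k)

    no-O-edge : ¬ Adj (Odd k) (encode (x , inj₂ p)) (encode (y , inj₂ q))
    no-O-edge d with proj₂ (Equivalence.to (snoc-disjoint (compl x) (compl y) true true) d)
    ... | ()

  Edge⇔-sym : ∀ u v → Edge⇔ u v → Edge⇔ v u
  Edge⇔-sym u v e = ⇔.trans (G-swap v u) (⇔.trans e (O-swap (encode u) (encode v)))
    where
    G-flip : ∀ a b → Adj (Gk+ k) a b → Adj (Gk+ k) b a
    G-flip a b (inj₁ d≡1) = inj₁ (trans (hamming-sym (proj₁ b) (proj₁ a)) d≡1)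
    G-flip a b (inj₂ (inj₁ c)) = inj₂ (inj₂ c)
    G-flip a b (inj₂ (inj₂ c)) = inj₂ (inj₁ c)

    G-swap : ∀ a b → Adj (Gk+ k) a b ⇔ Adj (Gk+ k) b a
    G-swap a b = mk⇔ (G-flip a b) (G-flip b a)

    O-swap : ∀ s t → Adj (Odd k) s t ⇔ Adj (Odd k) t s
    O-swap s t = mk⇔ (trans (∩-comm (proj₁ t) (proj₁ s))) (trans (∩-comm (proj₁ s) (proj₁ t)))

  edges : ∀ u v → Edge⇔ u v
  edges (x , inj₁ p) (y , inj₁ q) = edges-00 x y p q
  edges (x , inj₁ p) (y , inj₂ q) = edges-01 x y p q
  edges (x , inj₂ p) (y , inj₁ q) = Edge⇔-sym (y , inj₁ q) (x , inj₂ p) (edges-01 y x q p)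
  edges (x , inj₂ p) (y , inj₂ q) = edges-11 x y p q

lemma4 : (k : ℕ) → k ≥ 1 → Gk+ k ≅ Odd k
lemma4 k _ = record
  { bij  = bijection
  ; adj⇔ = λ u v → Equivalence.to (edges u v) , Equivalence.from (edges u v)
  }
  where open Isomorphism k
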